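{- Let $k\geq l\geq 1$ and let $T_{k,l}$ be the set of families of positive integers $T=(a_i,b_i)_{1\leq i\leq k-l}$ such that $a_i>b_i$ and $a_i\leq l+i$ for all $i$, and $a_i\geq b_{i+1}$ for $1\leq i<k-l$ (these are the row-strict plane partitions of skew shape $(k-l+1,k-l,\ldots,2)/(k-l-1,k-l-2,\ldots,0)$, row $i$ having entries $a_i,b_i$ from left to right, with largest entry in row $i$ at most $l+i$). Put $|T|=\sum_{i=1}^{k-l}(a_i+b_i)$. Then $$c_{k,l}(q)=\sum_{T\in T_{k,l}}q^{k^2-l^2-|T|}.$$
   Context: For $m\in\mathbb Z$, $r\in\mathbb N$: $(x;q)_r=(1-x)(1-xq)\cdots(1-xq^{r-1})$, ${m\brack r}_q=\frac{(q^{m-r+1};q)_r}{(q;q)_r}$, and entries with negative lower index are $0$. Let $G_q=\left({i\brack 2i-2j}_q\,q^{(i-j-1)(i-j)}\right)_{i,j\geq 1}$ (lower unitriangular) and $G_q^{ -1}=((-1)^{i-j}c_{i,j}(q))_{i,j\geq 1}$. A row-strict plane partition of a skew shape is a filling of its cells by positive integers strictly decreasing from left to right along rows and weakly decreasing from top to bottom along (geometric) columns; in the shape above, the left cell of row $i$ and the right cell of row $i+1$ lie in the same column. -}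

module Defs where

open import Level using (Level)
open import Data.Nat using (ℕ; zero; suc; _∸_; _≤ᵇ_; _<ᵇ_; _≡ᵇ_) renaming (_+_ to _+ℕ_; _*_ to _*ℕ_)
open import Data.Bool using (Bool; true; false; _∧_; if_then_else_)
open import Data.Product using (_×_; _,_)
open import Data.List using (List; []; _∷_; map; concatMap; applyUpTo; filter; foldr)
open import Data.Vec using (Vec; []; _∷_)
open import Relation.Nullary.Decidable using (yes; no)
open import Data.Bool.Properties using (T?)
open import Algebra.Bundles using (CommutativeRing)

module _ {c ℓ : Level} (R : CommutativeRing c ℓ) where
  open CommutativeRing R

  pow : Carrier → ℕ → Carrier
  pow x zero = 1#
  pow x (suc n) = x * pow x n

  sgn : ℕ → Carrier
  sgn n = pow (- 1#) n

  sum1 : ℕ → (ℕ → Carrier) → Carrier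
  sum1 zero f = 0#
  sum1 (suc n) f = sum1 n f + f (suc n)

  δ : ℕ → ℕ → Carrier
  δ i m = if i ≡ᵇ m then 1# else 0#

  -- Gaussian binomial [m r]_q for m, r ∈ ℕ, via q-Pascal:
  -- [m+1, r+1] = [m, r] + q^(r+1) [m, r+1]; equals the paper's
  -- (q^{m-r+1};q)_r/(q;q)_r (and 0 when r > m).
  qbinom : Carrier → ℕ → ℕ → Carrier
  qbinom q m zero = 1#
  qbinom q zero (suc r) = 0#
  qbinom q (suc m) (suc r) = qbinom q m r + pow q (suc r) * qbinom q m (suc r)

  -- G_q entry (i,j): [i, 2i-2j]_q q^{(i-j-1)(i-j)} for j ≤ i, and 0 for j > i
  -- (negative lower index).
  Gq : Carrier → ℕ → ℕ → Carrier
  Gq q i j = if j ≤ᵇ i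
             then qbinom q i (2 *ℕ (i ∸ j)) * pow q (((i ∸ j) ∸ 1) *ℕ (i ∸ j))
             else 0#

  -- H is a (right) inverse of G_q on indices ≥ 1: (G_q H)_{i,m} = δ_{i,m}.
  -- Since G_q is lower triangular, the row sum runs over j = 1..i.
  IsInverseOfG : Carrier → (ℕ → ℕ → Carrier) → Set ℓ
  IsInverseOfG q H = ∀ (i m : ℕ) → 1 Data.Nat.≤ i → 1 Data.Nat.≤ m →
                     sum1 i (λ j → Gq q i j * H j m) ≈ δ i m

  sumL : List Carrier → Carrier
  sumL = foldr _+_ 0#

  -- q^{k²-l²-|T|} (the exponent is ≥ 0 for every T in T_{k,l})
  weight : Carrier → ℕ → ℕ → {n : ℕ} → Vec (ℕ × ℕ) n → Carrier
  weight q k l T = pow q ((k *ℕ k ∸ l *ℕ l) ∸ size T)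
    where
    size : {n : ℕ} → Vec (ℕ × ℕ) n → ℕ
    size [] = 0
    size ((a , b) ∷ rest) = a +ℕ b +ℕ size rest

  Tsum : Carrier → ℕ → ℕ → Carrier
  Tsum q k l = sumL (map (weight q k l) (filter (λ T → T? (isT l T)) (allFams (k ∸ l))))
    where
    -- candidate families: all vectors of pairs with entries in {1..k}
    -- (any T ∈ T_{k,l} has a_i ≤ l+i ≤ k and b_i < a_i)
    box : List (ℕ × ℕ)
    box = concatMap (λ a → map (λ b → a , b) (applyUpTo suc k)) (applyUpTo suc k)
    allFams : (n : ℕ) → List (Vec (ℕ × ℕ) n)
    allFams zero = [] ∷ []
    allFams (suc n) = concatMap (λ p → map (p ∷_) (allFams n)) box
    link : ℕ → {n : ℕ} → Vec (ℕ × ℕ) n → Bool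
    link a [] = true
    link a ((a' , b') ∷ _) = b' ≤ᵇ a
    rowsOK : ℕ → ℕ → {n : ℕ} → Vec (ℕ × ℕ) n → Bool
    rowsOK l i [] = true
    rowsOK l i ((a , b) ∷ rest) =
      (1 ≤ᵇ b) ∧ (b <ᵇ a) ∧ (a ≤ᵇ l +ℕ i) ∧ link a rest ∧ rowsOK l (suc i) rest
    isT : ℕ → {n : ℕ} → Vec (ℕ × ℕ) n → Bool
    isT l T = rowsOK l 1 T

{-# OPTIONS --safe #-}
-- Let D n m c be the generating function of the fillings by n rows whose first row (a, b) has a ≤ m + 1
-- and b ≤ c, each row contributing q to the power of the gaps between its entries and the largest values
-- allowed there; for T ∈ T_{k,l} these gaps add up to k² - l² - |T|, so Tsum k l = D (k - l) l l.
-- Removing the first row gives a recursion for D, and with it, by induction on N, the alternating sum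
-- Σ_n G_q(m + N, m + n) (-1)^n D n m c equals the single entry [m - c + N, 2N]_q q^((N - 1)N) of G_q:
-- the induction step telescopes over c by the q-Pascal rule and a q-hockey-stick identity. For c = m this
-- entry is δ_{N,0}, so the column ((-1)^(j - m) D (j - m) m m)_j is a right inverse of G_q; as G_q is
-- unitriangular, it is the only one.
module Submission where

open import Defs
open import Level using (Level; 0ℓ)
open import Function using (_∘_; _⇔_; mk⇔; Equivalence)
open import Data.Bool using (Bool; true; false; T; _∧_; if_then_else_)
open import Data.Bool.Properties using (T?; T-∧)
open import Data.Empty using (⊥-elim)
open import Data.Fin using (toℕ)
open import Data.Fin.Properties using (toℕ<n; toℕ-inject₁; toℕ-fromℕ; opposite-prop)
import Data.Fin.Permutation as Permutation
open import Data.List using (List; []; _∷_; map; concatMap; applyUpTo; filter; _++_)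
open import Data.Nat using (ℕ; zero; suc; _∸_; _≤_; _<_; _≤ᵇ_; _<ᵇ_; z≤n; s≤s)
  renaming (_+_ to _+ℕ_; _*_ to _*ℕ_)
import Data.Nat.Properties as ℕ
open import Data.Nat.Tactic.RingSolver using (solve-∀)
open import Data.Product using (_×_; _,_; proj₁; proj₂)
open import Data.Vec using (Vec; []; _∷_)
open import Relation.Binary.PropositionalEquality as ≡ using (_≡_)
open import Relation.Nullary using (¬_; yes; no)
open import Relation.Unary using (Pred; Decidable)
open import Data.Sum using (inj₁; inj₂)
open import Algebra.Bundles using (CommutativeRing)

-- Arithmetic

<∸-swap : ∀ {c m s} → c < m ∸ s → s < m ∸ c
<∸-swap {c} {m} {s} c<m∸s =
  ℕ.m+n≤o⇒m≤o∸n (suc s) (ℕ.≤-trans (ℕ.≤-reflexive (≡.cong suc (ℕ.+-comm s c)))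
                                    (ℕ.m≤o∸n⇒m+n≤o (suc c) s≤m c<m∸s))
  where
  s≤m : s ≤ m
  s≤m = ℕ.<⇒≤ (ℕ.m∸n≢0⇒n<m (ℕ.m<n⇒n≢0 c<m∸s))

<ᵇ⇔< : ∀ x y → T (x <ᵇ y) ⇔ x < y
<ᵇ⇔< x y = mk⇔ (ℕ.<ᵇ⇒< x y) ℕ.<⇒<ᵇ

2*-suc : ∀ n → 2 *ℕ suc n ≡ suc (suc (2 *ℕ n))
2*-suc = solve-∀

n+n≡2*n : ∀ n → n +ℕ n ≡ 2 *ℕ n
n+n≡2*n n = ≡.cong (n +ℕ_) (≡.sym (ℕ.+-identityʳ n))

[p+n]∸2n≡p∸n : ∀ p n → (p +ℕ n) ∸ 2 *ℕ n ≡ p ∸ n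
[p+n]∸2n≡p∸n p n = ≡.trans (≡.cong₂ _∸_ (ℕ.+-comm p n) (≡.sym (n+n≡2*n n))) (ℕ.[m+n]∸[m+o]≡n∸o n p n)

pascal-exponent : ∀ {m r} → suc r ≤ m → suc (suc r) +ℕ (m ∸ suc r) ≡ (m ∸ r) +ℕ suc r
pascal-exponent {m} {r} r<m = begin
  suc (suc r +ℕ (m ∸ suc r))   ≡⟨ ≡.cong suc (ℕ.m+[n∸m]≡n r<m) ⟩
  suc m                        ≡⟨ ≡.cong suc (ℕ.m∸n+n≡m (ℕ.<⇒≤ r<m)) ⟨
  suc ((m ∸ r) +ℕ r)           ≡⟨ ℕ.+-suc (m ∸ r) r ⟨
  (m ∸ r) +ℕ suc r             ∎
  where open ≡.≡-Reasoning

hockey-exponent : ∀ {N P} → 2 *ℕ N ≤ P +ℕ N → P ≡ N +ℕ ((P +ℕ N) ∸ 2 *ℕ N)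
hockey-exponent {N} {P} 2N≤P+N = begin
  P                              ≡⟨ ℕ.m+[n∸m]≡n N≤P ⟨
  N +ℕ (P ∸ N)                   ≡⟨ ≡.cong (N +ℕ_) ([p+n]∸2n≡p∸n P N) ⟨
  N +ℕ ((P +ℕ N) ∸ 2 *ℕ N)       ∎
  where
  open ≡.≡-Reasoning
  N≤P : N ≤ P
  N≤P = ℕ.+-cancelʳ-≤ N N P (ℕ.≤-trans (ℕ.≤-reflexive (n+n≡2*n N)) 2N≤P+N)

g-exponent : ∀ {N p} → suc (2 *ℕ N) ≤ p +ℕ suc N →
             p +ℕ ((N ∸ 1) *ℕ N +ℕ N) ≡ ((p +ℕ suc N) ∸ suc (2 *ℕ N)) +ℕ N *ℕ suc N
g-exponent {N} {p} bound = begin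
  p +ℕ ((N ∸ 1) *ℕ N +ℕ N)                      ≡⟨ ≡.cong (p +ℕ_) (square N) ⟩
  p +ℕ N *ℕ N                                   ≡⟨ ≡.cong (_+ℕ N *ℕ N) (ℕ.m∸n+n≡m N≤p) ⟨
  (p ∸ N) +ℕ N +ℕ N *ℕ N                        ≡⟨ ℕ.+-assoc (p ∸ N) N (N *ℕ N) ⟩
  (p ∸ N) +ℕ (N +ℕ N *ℕ N)                      ≡⟨ ≡.cong ((p ∸ N) +ℕ_) (ℕ.*-suc N N) ⟨
  (p ∸ N) +ℕ N *ℕ suc N                         ≡⟨ ≡.cong (_+ℕ N *ℕ suc N) p+1+N∸1+2N≡p∸N ⟨
  ((p +ℕ suc N) ∸ suc (2 *ℕ N)) +ℕ N *ℕ suc N   ∎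
  where
  open ≡.≡-Reasoning
  square : ∀ N → (N ∸ 1) *ℕ N +ℕ N ≡ N *ℕ N
  square zero = ≡.refl
  square (suc N) = ℕ.+-comm (N *ℕ suc N) (suc N)
  p+1+N∸1+2N≡p∸N : (p +ℕ suc N) ∸ suc (2 *ℕ N) ≡ p ∸ N
  p+1+N∸1+2N≡p∸N = ≡.trans (≡.cong (_∸ suc (2 *ℕ N)) (ℕ.+-suc p N)) ([p+n]∸2n≡p∸n p N)
  N≤p : N ≤ p
  N≤p = ℕ.+-cancelʳ-≤ (suc N) N p (ℕ.≤-trans (ℕ.≤-reflexive (≡.trans (ℕ.+-suc N N) (≡.cong suc (n+n≡2*n N)))) bound)

-- Row-strict fillings

Row : Set
Row = ℕ × ℕ

pairsUpTo : ℕ → List Row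
pairsUpTo k = concatMap (λ a → map (a ,_) (applyUpTo suc k)) (applyUpTo suc k)

families : ℕ → (n : ℕ) → List (Vec Row n)
families k zero = [] ∷ []
families k (suc n) = concatMap (λ p → map (p ∷_) (families k n)) (pairsUpTo k)

link : ℕ → ∀ {n} → Vec Row n → Bool
link c [] = true
link c ((_ , b) ∷ _) = b ≤ᵇ c

rows : ℕ → ∀ {n} → Vec Row n → Bool
rows u [] = true
rows u ((a , b) ∷ ts) = (1 ≤ᵇ b) ∧ (b <ᵇ a) ∧ (a ≤ᵇ u) ∧ link a ts ∧ rows (suc u) ts

∣_∣ : ∀ {n} → Vec Row n → ℕ
∣ [] ∣ = 0
∣ (a , b) ∷ ts ∣ = a +ℕ b +ℕ ∣ ts ∣

coSize : ℕ → ∀ {n} → Vec Row n → ℕ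
coSize u [] = 0
coSize u ((a , b) ∷ ts) = (u ∸ a) +ℕ (u ∸ suc b) +ℕ coSize (suc u) ts

rows-∷ : ∀ {u a b n} {ts : Vec Row n} → T (rows u ((a , b) ∷ ts)) → b < a × a ≤ u × T (rows (suc u) ts)
rows-∷ {u} {a} {b} {ts = ts} valid =
  let _ , valid₁ = Equivalence.to (T-∧ {1 ≤ᵇ b}) valid
      b<a , valid₂ = Equivalence.to (T-∧ {b <ᵇ a}) valid₁
      a≤u , valid₃ = Equivalence.to (T-∧ {a ≤ᵇ u}) valid₂
  in ℕ.<ᵇ⇒< b a b<a , ℕ.≤ᵇ⇒≤ a u a≤u , proj₂ (Equivalence.to (T-∧ {link a ts}) valid₃)

rows⇒link : ∀ {u n} (ts : Vec Row n) → T (rows (suc u) ts) → T (link u ts)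
rows⇒link [] _ = _
rows⇒link {u} ((a , b) ∷ ts) valid =
  let b<a , a≤1+u , _ = rows-∷ {suc u} {a} {b} {ts = ts} valid in ℕ.≤⇒≤ᵇ (ℕ.≤-pred (ℕ.<-≤-trans b<a a≤1+u))

size+coSize : ∀ m {n} (ts : Vec Row n) → T (rows (suc m) ts) →
              m *ℕ m +ℕ (∣ ts ∣ +ℕ coSize (suc m) ts) ≡ (m +ℕ n) *ℕ (m +ℕ n)
size+coSize m [] _ = square m
  where square : ∀ m → m *ℕ m +ℕ 0 ≡ (m +ℕ 0) *ℕ (m +ℕ 0)
        square = solve-∀
size+coSize m {suc n} ((a , b) ∷ ts) valid = begin
  m *ℕ m +ℕ ((a +ℕ b +ℕ ∣ ts ∣) +ℕ ((suc m ∸ a) +ℕ (suc m ∸ suc b) +ℕ coSize (suc (suc m)) ts))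
    ≡⟨ regroup m a b (suc m ∸ a) (m ∸ b) ∣ ts ∣ (coSize (suc (suc m)) ts) ⟩
  (a +ℕ (suc m ∸ a)) +ℕ (b +ℕ (m ∸ b)) +ℕ m *ℕ m +ℕ (∣ ts ∣ +ℕ coSize (suc (suc m)) ts)
    ≡⟨ ≡.cong₂ (λ x y → x +ℕ y +ℕ m *ℕ m +ℕ (∣ ts ∣ +ℕ coSize (suc (suc m)) ts))
               (ℕ.m+[n∸m]≡n a≤1+m) (ℕ.m+[n∸m]≡n (ℕ.≤-pred (ℕ.<-≤-trans b<a a≤1+m))) ⟩
  suc m +ℕ m +ℕ m *ℕ m +ℕ (∣ ts ∣ +ℕ coSize (suc (suc m)) ts)
    ≡⟨ next-square m (∣ ts ∣ +ℕ coSize (suc (suc m)) ts) ⟩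
  suc m *ℕ suc m +ℕ (∣ ts ∣ +ℕ coSize (suc (suc m)) ts)
    ≡⟨ size+coSize (suc m) ts valid′ ⟩
  (suc m +ℕ n) *ℕ (suc m +ℕ n)
    ≡⟨ ≡.cong (λ k → k *ℕ k) (ℕ.+-suc m n) ⟨
  (m +ℕ suc n) *ℕ (m +ℕ suc n) ∎
  where
  open ≡.≡-Reasoning
  b<a = proj₁ (rows-∷ {suc m} {a} {b} {ts = ts} valid)
  a≤1+m = proj₁ (proj₂ (rows-∷ {suc m} {a} {b} {ts = ts} valid))
  valid′ = proj₂ (proj₂ (rows-∷ {suc m} {a} {b} {ts = ts} valid))
  regroup : ∀ m a b x y s c → m *ℕ m +ℕ ((a +ℕ b +ℕ s) +ℕ (x +ℕ y +ℕ c)) ≡ (a +ℕ x) +ℕ (b +ℕ y) +ℕ m *ℕ m +ℕ (s +ℕ c)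
  regroup = solve-∀
  next-square : ∀ m z → suc m +ℕ m +ℕ m *ℕ m +ℕ z ≡ suc m *ℕ suc m +ℕ z
  next-square = solve-∀

weight-exponent : ∀ l {n} (ts : Vec Row n) → T (rows (suc l) ts) →
                  ((l +ℕ n) *ℕ (l +ℕ n) ∸ l *ℕ l) ∸ ∣ ts ∣ ≡ coSize (suc l) ts
weight-exponent l ts valid = begin
  ((l +ℕ _) *ℕ (l +ℕ _) ∸ l *ℕ l) ∸ ∣ ts ∣
    ≡⟨ ≡.cong (λ x → (x ∸ l *ℕ l) ∸ ∣ ts ∣) (size+coSize l ts valid) ⟨
  (l *ℕ l +ℕ (∣ ts ∣ +ℕ coSize (suc l) ts) ∸ l *ℕ l) ∸ ∣ ts ∣ ≡⟨ ≡.cong (_∸ ∣ ts ∣) (ℕ.m+n∸m≡n (l *ℕ l) _) ⟩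
  (∣ ts ∣ +ℕ coSize (suc l) ts) ∸ ∣ ts ∣                      ≡⟨ ℕ.m+n∸m≡n ∣ ts ∣ _ ⟩
  coSize (suc l) ts                                          ∎
  where open ≡.≡-Reasoning

families-unique : ∀ k (fams : (n : ℕ) → List (Vec Row n)) → fams 0 ≡ [] ∷ [] →
                  (∀ n → fams (suc n) ≡ concatMap (λ p → map (p ∷_) (fams n)) (pairsUpTo k)) →
                  ∀ n → fams n ≡ families k n
families-unique k fams nil cons zero = nil
families-unique k fams nil cons (suc n) =
  ≡.trans (cons n) (≡.cong (λ fs → concatMap (λ p → map (p ∷_) fs) (pairsUpTo k)) (families-unique k fams nil cons n))

link-unique : (lnk : ℕ → ∀ {n} → Vec Row n → Bool) → (∀ c → lnk c [] ≡ true) →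
              (∀ c a b {n} (ts : Vec Row n) → lnk c ((a , b) ∷ ts) ≡ (b ≤ᵇ c)) →
              ∀ c {n} (ts : Vec Row n) → lnk c ts ≡ link c ts
link-unique lnk nil cons c [] = nil c
link-unique lnk nil cons c ((a , b) ∷ ts) = cons c a b ts

rows-unique : ∀ l (lnk : ℕ → ∀ {n} → Vec Row n → Bool) → (∀ c → lnk c [] ≡ true) →
              (∀ c a b {n} (ts : Vec Row n) → lnk c ((a , b) ∷ ts) ≡ (b ≤ᵇ c)) →
              (ok : ℕ → ∀ {n} → Vec Row n → Bool) → (∀ i → ok i [] ≡ true) →
              (∀ i a b {n} (ts : Vec Row n) →
                ok i ((a , b) ∷ ts) ≡ ((1 ≤ᵇ b) ∧ (b <ᵇ a) ∧ (a ≤ᵇ l +ℕ i) ∧ lnk a ts ∧ ok (suc i) ts)) →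
              ∀ i {n} (ts : Vec Row n) → ok i ts ≡ rows (l +ℕ i) ts
rows-unique l lnk lnk-nil lnk-cons ok nil cons i [] = nil i
rows-unique l lnk lnk-nil lnk-cons ok nil cons i ((a , b) ∷ ts) =
  ≡.trans (cons i a b ts)
    (≡.cong₂ (λ x y → (1 ≤ᵇ b) ∧ (b <ᵇ a) ∧ (a ≤ᵇ l +ℕ i) ∧ x ∧ y)
      (link-unique lnk lnk-nil lnk-cons a ts)
      (≡.trans (rows-unique l lnk lnk-nil lnk-cons ok nil cons (suc i) ts) (≡.cong (λ u → rows u ts) (ℕ.+-suc l i))))

size-unique : (sz : ∀ {m} → Vec Row m → ∀ {n} → Vec Row n → ℕ) →
              (∀ {m} (ts₀ : Vec Row m) → sz ts₀ [] ≡ 0) →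
              (∀ {m} (ts₀ : Vec Row m) a b {n} (ts : Vec Row n) → sz ts₀ ((a , b) ∷ ts) ≡ a +ℕ b +ℕ sz ts₀ ts) →
              ∀ {m} (ts₀ : Vec Row m) {n} (ts : Vec Row n) → sz ts₀ ts ≡ ∣ ts ∣
size-unique sz nil cons ts₀ [] = nil ts₀
size-unique sz nil cons ts₀ ((a , b) ∷ ts) =
  ≡.trans (cons ts₀ a b ts) (≡.cong (a +ℕ b +ℕ_) (size-unique sz nil cons ts₀ ts))

Filter : ℕ → Set₁
Filter n = {P : Pred (Vec Row n) 0ℓ} → Decidable P → List (Vec Row n) → List (Vec Row n)

-- Finite sums in a commutative ring

module Sums {c ℓ : Level} (R : CommutativeRing c ℓ) where
  open CommutativeRing R hiding (zero)
  open import Algebra.Properties.Semiring.Sum semiring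
    using (sum; sum-cong-≋; sum-cong-≗; sum-init-last; sum-replicate-zero;
           ∑-distrib-+; ∑-comm; ∑-permute; *-distribˡ-sum)
  open import Algebra.Properties.Ring ring using (+-cancelˡ; -1*x≈-x; -‿involutive)
  open import Algebra.Solver.Ring.NaturalCoefficients.Default commutativeSemiring using (solve; _:*_; _:=_)
  open import Relation.Binary.Reasoning.Setoid setoid

  when : Bool → Carrier → Carrier
  when β x = if β then x else 0#

  when-true : ∀ {β} x → T β → when β x ≡ x
  when-true {true} x _ = ≡.refl

  when-false : ∀ {β} x → ¬ T β → when β x ≡ 0#
  when-false {false} x _ = ≡.refl
  when-false {true} x ¬t = ⊥-elim (¬t _)

  when-cong : ∀ β {x y} → (T β → x ≈ y) → when β x ≈ when β y
  when-cong false _ = refl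
  when-cong true x≈y = x≈y _

  when-comm : ∀ β γ x → when β (when γ x) ≡ when γ (when β x)
  when-comm false false x = ≡.refl
  when-comm false true x = ≡.refl
  when-comm true false x = ≡.refl
  when-comm true true x = ≡.refl

  *-when : ∀ β x y → x * when β y ≈ when β (x * y)
  *-when false x y = zeroʳ x
  *-when true x y = refl

  when-∧-implied : ∀ {β γ x y} → (T β → T γ) → (T β → x ≈ y) → when β x ≈ when (γ ∧ β) y
  when-∧-implied {false} {false} _ _ = refl
  when-∧-implied {false} {true} _ _ = refl
  when-∧-implied {true} {false} β⇒γ _ = ⊥-elim (β⇒γ _)
  when-∧-implied {true} {true} _ x≈y = x≈y _

  -- Opaque, so that the summand of a sum can be inferred by unification.
  opaque
    Σ< : ℕ → (ℕ → Carrier) → Carrier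
    Σ< n f = sum {n} (f ∘ toℕ)

    Σ<-suc : ∀ n (f : ℕ → Carrier) → Σ< (suc n) f ≡ f 0 + Σ< n (f ∘ suc)
    Σ<-suc n f = ≡.refl

    Σ<-cong : ∀ n {f g : ℕ → Carrier} → (∀ s → s < n → f s ≈ g s) → Σ< n f ≈ Σ< n g
    Σ<-cong n f≈g = sum-cong-≋ (λ i → f≈g (toℕ i) (toℕ<n i))

    Σ<-zero : ∀ n {f : ℕ → Carrier} → (∀ s → s < n → f s ≈ 0#) → Σ< n f ≈ 0#
    Σ<-zero n f≈0 = trans (Σ<-cong n f≈0) (sum-replicate-zero n)

    Σ<-last : ∀ n (f : ℕ → Carrier) → Σ< (suc n) f ≈ Σ< n f + f n
    Σ<-last n f = trans (sum-init-last {n} (f ∘ toℕ))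
      (+-cong (reflexive (sum-cong-≗ {n} (≡.cong f ∘ toℕ-inject₁))) (reflexive (≡.cong f (toℕ-fromℕ n))))

    Σ<-+ : ∀ n (f g : ℕ → Carrier) → Σ< n (λ s → f s + g s) ≈ Σ< n f + Σ< n g
    Σ<-+ n f g = ∑-distrib-+ {n} (f ∘ toℕ) (g ∘ toℕ)

    Σ<-*ˡ : ∀ n x (f : ℕ → Carrier) → x * Σ< n f ≈ Σ< n (λ s → x * f s)
    Σ<-*ˡ n x f = *-distribˡ-sum {n} x (f ∘ toℕ)

    Σ<-comm : ∀ m n (f : ℕ → ℕ → Carrier) → Σ< m (λ s → Σ< n (f s)) ≈ Σ< n (λ t → Σ< m (λ s → f s t))
    Σ<-comm m n f = ∑-comm {m} {n} (λ i j → f (toℕ i) (toℕ j))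

    Σ<-reverse : ∀ n (f : ℕ → Carrier) → Σ< n (λ s → f (n ∸ suc s)) ≈ Σ< n f
    Σ<-reverse n f = sym (trans (∑-permute {n} (f ∘ toℕ) Permutation.reverse)
                                (reflexive (sum-cong-≗ {n} (≡.cong f ∘ opposite-prop))))

  Σ<-when : ∀ n β (f : ℕ → Carrier) → Σ< n (λ s → when β (f s)) ≈ when β (Σ< n f)
  Σ<-when n false f = Σ<-zero n (λ _ _ → refl)
  Σ<-when n true f = refl

  Σ<-empty : (f : ℕ → Carrier) → Σ< 0 f ≈ 0#
  Σ<-empty f = Σ<-zero 0 (λ _ ())

  Σ<-split : ∀ m n (f : ℕ → Carrier) → Σ< (m +ℕ n) f ≈ Σ< m f + Σ< n (λ s → f (m +ℕ s))
  Σ<-split zero n f = trans (sym (+-identityˡ _)) (+-congʳ (sym (Σ<-empty _)))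
  Σ<-split (suc m) n f = begin
    Σ< (suc m +ℕ n) f                                        ≡⟨ Σ<-suc (m +ℕ n) f ⟩
    f 0 + Σ< (m +ℕ n) (f ∘ suc)                              ≈⟨ +-congˡ (Σ<-split m n (f ∘ suc)) ⟩
    f 0 + (Σ< m (f ∘ suc) + Σ< n (λ s → f (suc m +ℕ s)))     ≈⟨ +-assoc _ _ _ ⟨
    (f 0 + Σ< m (f ∘ suc)) + Σ< n (λ s → f (suc m +ℕ s))     ≡⟨ ≡.cong (_+ Σ< n (λ s → f (suc m +ℕ s))) (Σ<-suc m f) ⟨
    Σ< (suc m) f + Σ< n (λ s → f (suc m +ℕ s))               ∎

  Σ<-restrict : ∀ {n M} (p : ℕ → Bool) (f : ℕ → Carrier) → M ≤ n → (∀ s → T (p s) ⇔ s < M) →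
                Σ< n (λ s → when (p s) (f s)) ≈ Σ< M f
  Σ<-restrict {n} {M} p f M≤n p⇔<M = begin
    Σ< n F                                  ≡⟨ ≡.cong (λ k → Σ< k F) (ℕ.m+[n∸m]≡n M≤n) ⟨
    Σ< (M +ℕ (n ∸ M)) F                     ≈⟨ Σ<-split M (n ∸ M) F ⟩
    Σ< M F + Σ< (n ∸ M) (λ s → F (M +ℕ s))  ≈⟨ +-cong (Σ<-cong M inside) (Σ<-zero (n ∸ M) outside) ⟩
    Σ< M f + 0#                             ≈⟨ +-identityʳ _ ⟩
    Σ< M f                                  ∎
    where
    F : ℕ → Carrier
    F s = when (p s) (f s)
    inside : ∀ s → s < M → F s ≈ f s
    inside s s<M = reflexive (when-true (f s) (Equivalence.from (p⇔<M s) s<M))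
    outside : ∀ s → s < n ∸ M → F (M +ℕ s) ≈ 0#
    outside s _ = reflexive (when-false (f (M +ℕ s))
                    (λ t → ℕ.<⇒≱ (Equivalence.to (p⇔<M (M +ℕ s)) t) (ℕ.m≤m+n M s)))

  Σ<-reflect-above : ∀ m c (f : ℕ → Carrier) → Σ< (suc m) (λ a → when (c <ᵇ a) (f (m ∸ a))) ≈ Σ< (m ∸ c) f
  Σ<-reflect-above m c f = begin
    Σ< (suc m) (λ a → when (c <ᵇ a) (f (m ∸ a)))            ≈⟨ Σ<-reverse (suc m) (λ a → when (c <ᵇ a) (f (m ∸ a))) ⟨
    Σ< (suc m) (λ s → when (c <ᵇ m ∸ s) (f (m ∸ (m ∸ s))))  ≈⟨ Σ<-cong (suc m) reflect ⟩
    Σ< (suc m) (λ s → when (c <ᵇ m ∸ s) (f s))              ≈⟨ Σ<-restrict (λ s → c <ᵇ m ∸ s) f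
                                                                 (ℕ.≤-trans (ℕ.m∸n≤m m c) (ℕ.n≤1+n m)) below ⟩
    Σ< (m ∸ c) f                                            ∎
    where
    reflect : ∀ s → s < suc m → when (c <ᵇ m ∸ s) (f (m ∸ (m ∸ s))) ≈ when (c <ᵇ m ∸ s) (f s)
    reflect s s<1+m = reflexive (≡.cong (λ t → when (c <ᵇ m ∸ s) (f t)) (ℕ.m∸[m∸n]≡n (ℕ.≤-pred s<1+m)))
    below : ∀ s → T (c <ᵇ m ∸ s) ⇔ s < m ∸ c
    below s = mk⇔ (<∸-swap ∘ Equivalence.to (<ᵇ⇔< c (m ∸ s))) (Equivalence.from (<ᵇ⇔< c (m ∸ s)) ∘ <∸-swap)

  sum1≈Σ< : ∀ n (f : ℕ → Carrier) → sum1 R n f ≈ Σ< n (f ∘ suc)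
  sum1≈Σ< zero f = sym (Σ<-empty _)
  sum1≈Σ< (suc n) f = trans (+-congʳ (sum1≈Σ< n f)) (sym (Σ<-last n (f ∘ suc)))

  sum1-cong : ∀ n {f g} → (∀ j → 1 ≤ j → j ≤ n → f j ≈ g j) → sum1 R n f ≈ sum1 R n g
  sum1-cong zero _ = refl
  sum1-cong (suc n) f≈g =
    +-cong (sum1-cong n (λ j 1≤j j≤n → f≈g j 1≤j (ℕ.m≤n⇒m≤1+n j≤n))) (f≈g (suc n) (s≤s z≤n) ℕ.≤-refl)

  unitriangular-cancel : (L : ℕ → ℕ → Carrier) → (∀ j → 1 ≤ j → L j j ≈ 1#) → (x y : ℕ → Carrier) →
                         (∀ i → 1 ≤ i → sum1 R i (λ j → L i j * x j) ≈ sum1 R i (λ j → L i j * y j)) →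
                         ∀ j → 1 ≤ j → x j ≈ y j
  unitriangular-cancel L diag x y Lx≈Ly j 1≤j = upTo j j 1≤j ℕ.≤-refl
    where
    upTo : ∀ i j → 1 ≤ j → j ≤ i → x j ≈ y j
    upTo zero j 1≤j j≤0 = ⊥-elim (ℕ.<⇒≱ 1≤j j≤0)
    upTo (suc i) j 1≤j j≤1+i with ℕ.m≤n⇒m<n∨m≡n j≤1+i
    ... | inj₁ j<1+i = upTo i j 1≤j (ℕ.≤-pred j<1+i)
    ... | inj₂ ≡.refl = begin
      x (suc i)                     ≈⟨ *-identityˡ _ ⟨
      1# * x (suc i)                ≈⟨ *-congʳ (diag (suc i) 1≤j) ⟨
      L (suc i) (suc i) * x (suc i) ≈⟨ +-cancelˡ (sum1 R i (λ j → L (suc i) j * x j)) _ _ last ⟩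
      L (suc i) (suc i) * y (suc i) ≈⟨ *-congʳ (diag (suc i) 1≤j) ⟩
      1# * y (suc i)                ≈⟨ *-identityˡ _ ⟩
      y (suc i)                     ∎
      where
      last : sum1 R i (λ j → L (suc i) j * x j) + L (suc i) (suc i) * x (suc i)
           ≈ sum1 R i (λ j → L (suc i) j * x j) + L (suc i) (suc i) * y (suc i)
      last = trans (Lx≈Ly (suc i) 1≤j)
               (+-congʳ (sum1-cong i (λ j 1≤j j≤i → *-congˡ (sym (upTo i j 1≤j j≤i)))))

  sgn-square : ∀ n → sgn R n * sgn R n ≈ 1#
  sgn-square zero = *-identityʳ 1#
  sgn-square (suc n) = begin
    (- 1# * sgn R n) * (- 1# * sgn R n)  ≈⟨ solve 2 (λ u s → (u :* s) :* (u :* s) := (u :* u) :* (s :* s))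
                                                     refl (- 1#) (sgn R n) ⟩
    (- 1# * - 1#) * (sgn R n * sgn R n)  ≈⟨ *-cong (trans (-1*x≈-x _) (-‿involutive 1#)) (sgn-square n) ⟩
    1# * 1#                              ≈⟨ *-identityʳ 1# ⟩
    1#                                   ∎

  ΣL : {A : Set} → (A → Carrier) → List A → Carrier
  ΣL f xs = sumL R (map f xs)

  ΣL-cong : ∀ {A : Set} {f g : A → Carrier} xs → (∀ x → f x ≈ g x) → ΣL f xs ≈ ΣL g xs
  ΣL-cong [] _ = refl
  ΣL-cong (x ∷ xs) f≈g = +-cong (f≈g x) (ΣL-cong xs f≈g)

  ΣL-zero : ∀ {A : Set} (xs : List A) → ΣL (λ _ → 0#) xs ≈ 0#
  ΣL-zero [] = refl
  ΣL-zero (x ∷ xs) = trans (+-congˡ (ΣL-zero xs)) (+-identityˡ 0#)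

  ΣL-*ˡ : ∀ {A : Set} x (f : A → Carrier) xs → x * ΣL f xs ≈ ΣL (λ y → x * f y) xs
  ΣL-*ˡ x f [] = zeroʳ x
  ΣL-*ˡ x f (y ∷ xs) = trans (distribˡ _ _ _) (+-congˡ (ΣL-*ˡ x f xs))

  ΣL-map : ∀ {A B : Set} (f : B → Carrier) (h : A → B) xs → ΣL f (map h xs) ≡ ΣL (f ∘ h) xs
  ΣL-map f h [] = ≡.refl
  ΣL-map f h (x ∷ xs) = ≡.cong (f (h x) +_) (ΣL-map f h xs)

  ΣL-++ : ∀ {A : Set} (f : A → Carrier) xs ys → ΣL f (xs ++ ys) ≈ ΣL f xs + ΣL f ys
  ΣL-++ f [] ys = sym (+-identityˡ _)
  ΣL-++ f (x ∷ xs) ys = trans (+-congˡ (ΣL-++ f xs ys)) (sym (+-assoc _ _ _))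

  ΣL-concatMap : ∀ {A B : Set} (f : B → Carrier) (h : A → List B) xs →
                 ΣL f (concatMap h xs) ≈ ΣL (λ x → ΣL f (h x)) xs
  ΣL-concatMap f h [] = refl
  ΣL-concatMap f h (x ∷ xs) = trans (ΣL-++ f (h x) (concatMap h xs)) (+-congˡ (ΣL-concatMap f h xs))

  ΣL-applyUpTo : ∀ {A : Set} (f : A → Carrier) (h : ℕ → A) n → ΣL f (applyUpTo h n) ≈ Σ< n (f ∘ h)
  ΣL-applyUpTo f h zero = sym (Σ<-empty _)
  ΣL-applyUpTo f h (suc n) =
    trans (+-congˡ (ΣL-applyUpTo f (h ∘ suc) n)) (reflexive (≡.sym (Σ<-suc n (f ∘ h))))

  ΣL-filter : ∀ {A : Set} (f : A → Carrier) (p : A → Bool) xs →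
              ΣL f (filter (λ x → T? (p x)) xs) ≈ ΣL (λ x → when (p x) (f x)) xs
  ΣL-filter f p [] = refl
  ΣL-filter f p (x ∷ xs) with p x
  ... | true = +-congˡ (ΣL-filter f p xs)
  ... | false = trans (ΣL-filter f p xs) (sym (+-identityˡ _))

  ΣL-when-∧ : ∀ {A : Set} β (p : A → Bool) (f : A → Carrier) xs →
              ΣL (λ x → when (β ∧ p x) (f x)) xs ≈ when β (ΣL (λ x → when (p x) (f x)) xs)
  ΣL-when-∧ false p f xs = ΣL-zero xs
  ΣL-when-∧ true p f xs = refl

  ΣL-pairsUpTo : ∀ k (h : Row → Carrier) → ΣL h (pairsUpTo k) ≈ Σ< k (λ a → Σ< k (λ b → h (suc a , suc b)))
  ΣL-pairsUpTo k h = begin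
    ΣL h (pairsUpTo k)
      ≈⟨ ΣL-concatMap h _ (applyUpTo suc k) ⟩
    ΣL (λ a → ΣL h (map (a ,_) (applyUpTo suc k))) (applyUpTo suc k)
      ≈⟨ ΣL-applyUpTo _ suc k ⟩
    Σ< k (λ a → ΣL h (map (suc a ,_) (applyUpTo suc k)))
      ≈⟨ Σ<-cong k (λ a _ → trans (reflexive (ΣL-map h _ (applyUpTo suc k))) (ΣL-applyUpTo _ suc k)) ⟩
    Σ< k (λ a → Σ< k (λ b → h (suc a , suc b))) ∎

-- Gaussian binomials

module _ {c ℓ : Level} (R : CommutativeRing c ℓ) (q : CommutativeRing.Carrier R) where
  open CommutativeRing R hiding (zero)
  open Sums R
  open import Relation.Binary.Reasoning.Setoid setoid
  open import Algebra.Properties.Ring ring using (-1*x≈-x)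
  open import Algebra.Properties.AbelianGroup +-abelianGroup using (xyx⁻¹≈y)
  open import Algebra.Solver.Ring.NaturalCoefficients.Default commutativeSemiring using (solve; _:+_; _:*_; _:=_; con)

  infix 9 q^_
  q^_ : ℕ → Carrier
  q^ n = pow R q n

  q^-+ : ∀ m n → q^ (m +ℕ n) ≈ q^ m * q^ n
  q^-+ zero n = sym (*-identityˡ _)
  q^-+ (suc m) n = trans (*-congˡ (q^-+ m n)) (sym (*-assoc q _ _))

  qbin : ℕ → ℕ → Carrier
  qbin = qbinom R q

  qbin-vanish : ∀ {m r} → m < r → qbin m r ≈ 0#
  qbin-vanish {zero} {suc r} _ = refl
  qbin-vanish {suc m} {suc r} (s≤s m<r) =
    trans (+-cong (qbin-vanish m<r) (trans (*-congˡ (qbin-vanish (ℕ.m<n⇒m<1+n m<r))) (zeroʳ _)))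
          (+-identityˡ 0#)

  q^*qbin-cong : ∀ {m r e e′} → (r ≤ m → e ≡ e′) → q^ e * qbin m r ≈ q^ e′ * qbin m r
  q^*qbin-cong {m} {r} e≡e′ with r ℕ.≤? m
  ... | yes r≤m = reflexive (≡.cong (λ e → q^ e * qbin m r) (e≡e′ r≤m))
  ... | no r≰m = trans (*-congˡ vanishes) (trans (zeroʳ _) (sym (trans (*-congˡ vanishes) (zeroʳ _))))
    where vanishes = qbin-vanish (ℕ.≰⇒> r≰m)

  qbin-pascalʳ : ∀ m r → qbin (suc m) (suc r) ≈ qbin m (suc r) + q^ (m ∸ r) * qbin m r
  qbin-pascalʳ zero zero =
    solve 1 (λ x → con 1 :+ (x :* con 1) :* con 0 := con 0 :+ con 1 :* con 1) refl q
  qbin-pascalʳ zero (suc r) = trans (+-congˡ (zeroʳ _)) (sym (+-congˡ (zeroʳ _)))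
  qbin-pascalʳ (suc m) zero = begin
    1# + (q * 1#) * qbin (suc m) 1              ≈⟨ +-congˡ (*-congˡ (qbin-pascalʳ m zero)) ⟩
    1# + (q * 1#) * (qbin m 1 + q^ m * 1#)      ≈⟨ solve 3 (λ x b p → con 1 :+ (x :* con 1) :* (b :+ p :* con 1)
                                                    := (con 1 :+ (x :* con 1) :* b) :+ (x :* p) :* con 1)
                                                    refl q (qbin m 1) (q^ m) ⟩
    (1# + (q * 1#) * qbin m 1) + (q * q^ m) * 1# ∎
  qbin-pascalʳ (suc m) (suc r) = begin
    qbin (suc m) (suc r) + q^ (suc (suc r)) * qbin (suc m) (suc (suc r))
      ≈⟨ +-cong (qbin-pascalʳ m r) (*-congˡ (qbin-pascalʳ m (suc r))) ⟩
    (B₁ + q^ (m ∸ r) * B₀) + q^ (suc (suc r)) * (B₂ + q^ (m ∸ suc r) * B₁)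
      ≈⟨ solve 6 (λ b₀ b₁ b₂ p₀ p₁ a → (b₁ :+ p₀ :* b₀) :+ a :* (b₂ :+ p₁ :* b₁)
                                     := (b₁ :+ a :* b₂) :+ (p₀ :* b₀ :+ (a :* p₁) :* b₁))
                 refl B₀ B₁ B₂ (q^ (m ∸ r)) (q^ (m ∸ suc r)) (q^ (suc (suc r))) ⟩
    (B₁ + q^ (suc (suc r)) * B₂) + (q^ (m ∸ r) * B₀ + (q^ (suc (suc r)) * q^ (m ∸ suc r)) * B₁)
      ≈⟨ +-congˡ (+-congˡ cross) ⟩
    (B₁ + q^ (suc (suc r)) * B₂) + (q^ (m ∸ r) * B₀ + (q^ (m ∸ r) * q^ (suc r)) * B₁)
      ≈⟨ +-congˡ (solve 4 (λ p b₀ x b₁ → p :* b₀ :+ (p :* x) :* b₁ := p :* (b₀ :+ x :* b₁))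
                          refl (q^ (m ∸ r)) B₀ (q^ (suc r)) B₁) ⟩
    (B₁ + q^ (suc (suc r)) * B₂) + q^ (m ∸ r) * (B₀ + q^ (suc r) * B₁) ∎
    where
    B₀ = qbin m r
    B₁ = qbin m (suc r)
    B₂ = qbin m (suc (suc r))
    cross : (q^ (suc (suc r)) * q^ (m ∸ suc r)) * B₁ ≈ (q^ (m ∸ r) * q^ (suc r)) * B₁
    cross = begin
      (q^ (suc (suc r)) * q^ (m ∸ suc r)) * B₁ ≈⟨ *-congʳ (q^-+ (suc (suc r)) (m ∸ suc r)) ⟨
      q^ (suc (suc r) +ℕ (m ∸ suc r)) * B₁      ≈⟨ q^*qbin-cong (pascal-exponent {m} {r}) ⟩
      q^ ((m ∸ r) +ℕ suc r) * B₁                ≈⟨ *-congʳ (q^-+ (m ∸ r) (suc r)) ⟩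
      (q^ (m ∸ r) * q^ (suc r)) * B₁            ∎

  qbin-hockey-stick : ∀ N P → Σ< P (λ s → q^ s * qbin (s +ℕ N) (2 *ℕ N)) ≈ q^ N * qbin (P +ℕ N) (suc (2 *ℕ N))
  qbin-hockey-stick N zero =
    trans (Σ<-empty _) (sym (trans (*-congˡ (qbin-vanish (s≤s (ℕ.m≤m+n N (N +ℕ 0))))) (zeroʳ _)))
  qbin-hockey-stick N (suc P) = begin
    Σ< (suc P) (λ s → q^ s * qbin (s +ℕ N) (2 *ℕ N))      ≈⟨ Σ<-last P (λ s → q^ s * qbin (s +ℕ N) (2 *ℕ N)) ⟩
    Σ< P (λ s → q^ s * qbin (s +ℕ N) (2 *ℕ N)) + q^ P * B  ≈⟨ +-cong (qbin-hockey-stick N P) shift ⟩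
    q^ N * qbin (P +ℕ N) (suc (2 *ℕ N)) + q^ N * (q^ ((P +ℕ N) ∸ 2 *ℕ N) * B)
                                                           ≈⟨ distribˡ _ _ _ ⟨
    q^ N * (qbin (P +ℕ N) (suc (2 *ℕ N)) + q^ ((P +ℕ N) ∸ 2 *ℕ N) * B)
                                                           ≈⟨ *-congˡ (qbin-pascalʳ (P +ℕ N) (2 *ℕ N)) ⟨
    q^ N * qbin (suc P +ℕ N) (suc (2 *ℕ N))               ∎
    where
    B = qbin (P +ℕ N) (2 *ℕ N)
    shift : q^ P * B ≈ q^ N * (q^ ((P +ℕ N) ∸ 2 *ℕ N) * B)
    shift = begin
      q^ P * B                                  ≈⟨ q^*qbin-cong (hockey-exponent {N} {P}) ⟩
      q^ (N +ℕ ((P +ℕ N) ∸ 2 *ℕ N)) * B         ≈⟨ *-congʳ (q^-+ N _) ⟩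
      (q^ N * q^ ((P +ℕ N) ∸ 2 *ℕ N)) * B       ≈⟨ *-assoc _ _ _ ⟩
      q^ N * (q^ ((P +ℕ N) ∸ 2 *ℕ N) * B)       ∎

  -- The generating function D and its alternating sums

  -- g i (i ∸ j) is the entry (i, j) of G_q for j ≤ i.
  g : ℕ → ℕ → Carrier
  g M d = qbin M (2 *ℕ d) * q^ ((d ∸ 1) *ℕ d)

  g-hockey-stick : ∀ N p → Σ< (suc p) (λ s → q^ (s +ℕ p) * g (s +ℕ N) N) + g (p +ℕ suc N) (suc N)
                          ≈ g (suc p +ℕ suc N) (suc N)
  g-hockey-stick N p = begin
    Σ< (suc p) (λ s → q^ (s +ℕ p) * g (s +ℕ N) N) + g M (suc N)
      ≈⟨ +-congʳ column ⟩
    (q^ p * q^ E) * (q^ N * B) + g M (suc N)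
      ≈⟨ +-congʳ (solve 4 (λ x y z b → (x :* y) :* (z :* b) := (x :* (y :* z)) :* b) refl (q^ p) (q^ E) (q^ N) B) ⟩
    (q^ p * (q^ E * q^ N)) * B + g M (suc N)
      ≈⟨ +-congʳ (*-congʳ (trans (q^-+ p (E +ℕ N)) (*-congˡ (q^-+ E N)))) ⟨
    q^ (p +ℕ (E +ℕ N)) * B + g M (suc N)
      ≈⟨ +-congʳ (q^*qbin-cong (g-exponent {N} {p})) ⟩
    q^ (M ∸ suc (2 *ℕ N) +ℕ N *ℕ suc N) * B + g M (suc N)
      ≈⟨ +-congʳ (*-congʳ (q^-+ (M ∸ suc (2 *ℕ N)) (N *ℕ suc N))) ⟩
    (q^ (M ∸ suc (2 *ℕ N)) * q^ (N *ℕ suc N)) * B + qbin M (2 *ℕ suc N) * q^ (N *ℕ suc N)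
      ≡⟨ ≡.cong (λ r → (q^ (M ∸ suc (2 *ℕ N)) * q^ (N *ℕ suc N)) * B + qbin M r * q^ (N *ℕ suc N)) (2*-suc N) ⟩
    (q^ (M ∸ suc (2 *ℕ N)) * q^ (N *ℕ suc N)) * B + qbin M (suc (suc (2 *ℕ N))) * q^ (N *ℕ suc N)
      ≈⟨ solve 4 (λ x y b b′ → (x :* y) :* b :+ b′ :* y := (b′ :+ x :* b) :* y)
               refl (q^ (M ∸ suc (2 *ℕ N))) (q^ (N *ℕ suc N)) B (qbin M (suc (suc (2 *ℕ N)))) ⟩
    (qbin M (suc (suc (2 *ℕ N))) + q^ (M ∸ suc (2 *ℕ N)) * B) * q^ (N *ℕ suc N)
      ≈⟨ *-congʳ (qbin-pascalʳ M (suc (2 *ℕ N))) ⟨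
    qbin (suc M) (suc (suc (2 *ℕ N))) * q^ (N *ℕ suc N)
      ≡⟨ ≡.cong (λ r → qbin (suc M) r * q^ (N *ℕ suc N)) (2*-suc N) ⟨
    g (suc p +ℕ suc N) (suc N) ∎
    where
    M = p +ℕ suc N
    E = (N ∸ 1) *ℕ N
    B = qbin M (suc (2 *ℕ N))
    column : Σ< (suc p) (λ s → q^ (s +ℕ p) * g (s +ℕ N) N) ≈ (q^ p * q^ E) * (q^ N * B)
    column = begin
      Σ< (suc p) (λ s → q^ (s +ℕ p) * g (s +ℕ N) N)
        ≈⟨ Σ<-cong (suc p) (λ s _ → trans (*-congʳ (q^-+ s p))
             (solve 4 (λ x y b e → (x :* y) :* (b :* e) := (y :* e) :* (x :* b))
                      refl (q^ s) (q^ p) (qbin (s +ℕ N) (2 *ℕ N)) (q^ E))) ⟩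
      Σ< (suc p) (λ s → (q^ p * q^ E) * (q^ s * qbin (s +ℕ N) (2 *ℕ N)))
        ≈⟨ Σ<-*ˡ (suc p) (q^ p * q^ E) (λ s → q^ s * qbin (s +ℕ N) (2 *ℕ N)) ⟨
      (q^ p * q^ E) * Σ< (suc p) (λ s → q^ s * qbin (s +ℕ N) (2 *ℕ N))
        ≈⟨ *-congˡ (qbin-hockey-stick N (suc p)) ⟩
      (q^ p * q^ E) * (q^ N * qbin (suc p +ℕ N) (suc (2 *ℕ N)))
        ≡⟨ ≡.cong (λ m → (q^ p * q^ E) * (q^ N * qbin m (suc (2 *ℕ N)))) (ℕ.+-suc p N) ⟨
      (q^ p * q^ E) * (q^ N * B) ∎

  -- Prepends a first row (a + 1, b + 1) with b < a ≤ m and b < c, weighted by its gaps (m + 1) - (a + 1)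
  -- and m - (b + 1) to the largest allowed entries, to the fillings counted by F a.
  addRow : ℕ → ℕ → (ℕ → Carrier) → Carrier
  addRow m c F = Σ< (suc m) λ a → Σ< c λ b → when (b <ᵇ a) (q^ ((m ∸ a) +ℕ (m ∸ suc b)) * F a)

  D : ℕ → ℕ → ℕ → Carrier
  D zero m c = 1#
  D (suc n) m c = addRow m c (λ a → D n (suc m) (suc a))

  addRow-cong : ∀ m c {F F′ : ℕ → Carrier} → (∀ a → a ≤ m → F a ≈ F′ a) → addRow m c F ≈ addRow m c F′
  addRow-cong m c F≈F′ =
    Σ<-cong (suc m) (λ a a≤m → Σ<-cong c (λ b _ → when-cong (b <ᵇ a) (λ _ → *-congˡ (F≈F′ a (ℕ.≤-pred a≤m)))))

  addRow-linear : ∀ m c N (x : ℕ → Carrier) (F : ℕ → ℕ → Carrier) →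
                  Σ< N (λ n → x n * addRow m c (F n)) ≈ addRow m c (λ a → Σ< N (λ n → x n * F n a))
  addRow-linear m c N x F = begin
    Σ< N (λ n → x n * addRow m c (F n))
      ≈⟨ Σ<-cong N (λ n _ → trans (Σ<-*ˡ (suc m) (x n) (λ a → Σ< c (term n a)))
                                   (Σ<-cong (suc m) (λ a _ → Σ<-*ˡ c (x n) (term n a)))) ⟩
    Σ< N (λ n → Σ< (suc m) λ a → Σ< c λ b → x n * term n a b)
      ≈⟨ Σ<-comm N (suc m) (λ n a → Σ< c λ b → x n * term n a b) ⟩
    Σ< (suc m) (λ a → Σ< N λ n → Σ< c λ b → x n * term n a b)
      ≈⟨ Σ<-cong (suc m) (λ a _ → Σ<-comm N c (λ n b → x n * term n a b)) ⟩
    Σ< (suc m) (λ a → Σ< c λ b → Σ< N λ n → x n * term n a b)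
      ≈⟨ Σ<-cong (suc m) (λ a _ → Σ<-cong c (λ b _ → pull a b)) ⟩
    addRow m c (λ a → Σ< N (λ n → x n * F n a)) ∎
    where
    w : ℕ → ℕ → Carrier
    w a b = q^ ((m ∸ a) +ℕ (m ∸ suc b))
    term : ℕ → ℕ → ℕ → Carrier
    term n a b = when (b <ᵇ a) (w a b * F n a)
    pull : ∀ a b → Σ< N (λ n → x n * term n a b) ≈ when (b <ᵇ a) (w a b * Σ< N (λ n → x n * F n a))
    pull a b = begin
      Σ< N (λ n → x n * term n a b)
        ≈⟨ Σ<-cong N (λ n _ → trans (*-when (b <ᵇ a) _ _) (when-cong (b <ᵇ a) (λ _ →
             solve 3 (λ x w f → x :* (w :* f) := w :* (x :* f)) refl (x n) (w a b) (F n a)))) ⟩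
      Σ< N (λ n → when (b <ᵇ a) (w a b * (x n * F n a)))
        ≈⟨ Σ<-when N (b <ᵇ a) (λ n → w a b * (x n * F n a)) ⟩
      when (b <ᵇ a) (Σ< N (λ n → w a b * (x n * F n a)))
        ≈⟨ when-cong (b <ᵇ a) (λ _ → Σ<-*ˡ N (w a b) (λ n → x n * F n a)) ⟨
      when (b <ᵇ a) (w a b * Σ< N (λ n → x n * F n a)) ∎

  addRow-suc : ∀ m c F → addRow m (suc c) F
             ≈ addRow m c F + Σ< (suc m) (λ a → when (c <ᵇ a) (q^ ((m ∸ a) +ℕ (m ∸ suc c)) * F a))
  addRow-suc m c F = trans (Σ<-cong (suc m) (λ a _ → Σ<-last c _)) (Σ<-+ (suc m) _ _)

  addRow-g : ∀ N m c → c ≤ m →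
             addRow m c (λ a → g ((m ∸ a) +ℕ N) N) + g ((m ∸ c) +ℕ suc N) (suc N) ≈ g (m +ℕ suc N) (suc N)
  addRow-g N m zero _ = trans (+-congʳ (Σ<-zero (suc m) (λ _ _ → Σ<-empty _))) (+-identityˡ _)
  addRow-g N m (suc c) c<m = begin
    addRow m (suc c) G + g (p +ℕ suc N) (suc N)
      ≈⟨ +-congʳ (addRow-suc m c G) ⟩
    (addRow m c G + Σ< (suc m) (λ a → when (c <ᵇ a) (F (m ∸ a)))) + g (p +ℕ suc N) (suc N)
      ≈⟨ +-assoc _ _ _ ⟩
    addRow m c G + (Σ< (suc m) (λ a → when (c <ᵇ a) (F (m ∸ a))) + g (p +ℕ suc N) (suc N))
      ≈⟨ +-congˡ (+-congʳ (Σ<-reflect-above m c F)) ⟩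
    addRow m c G + (Σ< (m ∸ c) F + g (p +ℕ suc N) (suc N))
      ≡⟨ ≡.cong (λ k → addRow m c G + (Σ< k F + g (p +ℕ suc N) (suc N))) m∸c≡1+p ⟩
    addRow m c G + (Σ< (suc p) F + g (p +ℕ suc N) (suc N))
      ≈⟨ +-congˡ (g-hockey-stick N p) ⟩
    addRow m c G + g (suc p +ℕ suc N) (suc N)
      ≡⟨ ≡.cong (λ k → addRow m c G + g (k +ℕ suc N) (suc N)) m∸c≡1+p ⟨
    addRow m c G + g ((m ∸ c) +ℕ suc N) (suc N)
      ≈⟨ addRow-g N m c (ℕ.<⇒≤ c<m) ⟩
    g (m +ℕ suc N) (suc N) ∎
    where
    G : ℕ → Carrier
    G a = g ((m ∸ a) +ℕ N) N
    p = m ∸ suc c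
    F : ℕ → Carrier
    F s = q^ (s +ℕ p) * g (s +ℕ N) N
    m∸c≡1+p : m ∸ c ≡ suc p
    m∸c≡1+p = ℕ.+-∸-assoc 1 c<m

  alternatingSum : ℕ → ℕ → ℕ → Carrier
  alternatingSum N m c = Σ< (suc N) λ n → (g (m +ℕ N) (N ∸ n) * sgn R n) * D n m c

  alternatingSum≈g : ∀ N m c → c ≤ m → alternatingSum N m c ≈ g ((m ∸ c) +ℕ N) N
  alternatingSum≈g zero m c _ = trans (reflexive (Σ<-suc 0 _)) (trans (+-congˡ (Σ<-empty _))
                      (solve 0 (((con 1 :* con 1) :* con 1) :* con 1 :+ con 0 := con 1 :* con 1) refl))
  alternatingSum≈g (suc N) m c c≤m = begin
    alternatingSum (suc N) m c
      ≡⟨ Σ<-suc (suc N) _ ⟩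
    (g (m +ℕ suc N) (suc N) * 1#) * 1# + Σ< (suc N) (λ n → (g (m +ℕ suc N) (N ∸ n) * sgn R (suc n)) * D (suc n) m c)
      ≈⟨ +-cong (trans (*-identityʳ _) (*-identityʳ _)) (Σ<-cong (suc N) (λ n _ → sign n)) ⟩
    g (m +ℕ suc N) (suc N) + Σ< (suc N) (λ n → - 1# * (x n * addRow m c (F n)))
      ≈⟨ +-congˡ (Σ<-*ˡ (suc N) (- 1#) _) ⟨
    g (m +ℕ suc N) (suc N) + - 1# * Σ< (suc N) (λ n → x n * addRow m c (F n))
      ≈⟨ +-congˡ (*-congˡ (addRow-linear m c (suc N) x F)) ⟩
    g (m +ℕ suc N) (suc N) + - 1# * addRow m c (λ a → alternatingSum N (suc m) (suc a))
      ≈⟨ +-congˡ (*-congˡ (addRow-cong m c (λ a a≤m → alternatingSum≈g N (suc m) (suc a) (s≤s a≤m)))) ⟩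
    g (m +ℕ suc N) (suc N) + - 1# * X
      ≈⟨ +-cong (sym (addRow-g N m c c≤m)) (-1*x≈-x X) ⟩
    X + g ((m ∸ c) +ℕ suc N) (suc N) + - X
      ≈⟨ xyx⁻¹≈y X _ ⟩
    g ((m ∸ c) +ℕ suc N) (suc N) ∎
    where
    x : ℕ → Carrier
    x n = g (suc m +ℕ N) (N ∸ n) * sgn R n
    F : ℕ → ℕ → Carrier
    F n a = D n (suc m) (suc a)
    X = addRow m c (λ a → g ((m ∸ a) +ℕ N) N)
    sign : ∀ n → (g (m +ℕ suc N) (N ∸ n) * sgn R (suc n)) * D (suc n) m c ≈ - 1# * (x n * addRow m c (F n))
    sign n = begin
      (g (m +ℕ suc N) (N ∸ n) * (- 1# * sgn R n)) * addRow m c (F n)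
        ≡⟨ ≡.cong (λ k → (g k (N ∸ n) * (- 1# * sgn R n)) * addRow m c (F n)) (ℕ.+-suc m N) ⟩
      (g (suc m +ℕ N) (N ∸ n) * (- 1# * sgn R n)) * addRow m c (F n)
        ≈⟨ solve 4 (λ y u s a → (y :* (u :* s)) :* a := u :* ((y :* s) :* a))
                   refl (g (suc m +ℕ N) (N ∸ n)) (- 1#) (sgn R n) (addRow m c (F n)) ⟩
      - 1# * (x n * addRow m c (F n)) ∎

  -- The inverse of G_q

  Gq≡g : ∀ {i j} → j ≤ i → Gq R q i j ≡ g i (i ∸ j)
  Gq≡g j≤i = when-true _ (ℕ.≤⇒≤ᵇ j≤i)

  g-diagonal : ∀ m N → g N N ≈ δ R (m +ℕ N) m
  g-diagonal m zero = trans (*-identityʳ 1#) (sym (reflexive (when-true 1# (ℕ.≡⇒≡ᵇ _ _ (ℕ.+-identityʳ m)))))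
  g-diagonal m (suc N) = trans (*-congʳ (qbin-vanish (ℕ.m<m+n (suc N) (s≤s z≤n)))) (trans (zeroˡ _)
    (sym (reflexive (when-false 1# (λ t → ℕ.m≢1+m+n m (≡.trans (≡.sym (ℕ.≡ᵇ⇒≡ _ _ t)) (ℕ.+-suc m N)))))))

  Ginv : ℕ → ℕ → Carrier
  Ginv j m = when (m ≤ᵇ j) (sgn R (j ∸ m) * D (j ∸ m) m m)

  Ginv-above : ∀ {j m} → j < m → Ginv j m ≡ 0#
  Ginv-above {j} {m} j<m = when-false _ (ℕ.<⇒≱ j<m ∘ ℕ.≤ᵇ⇒≤ m j)

  Ginv-column : ∀ m′ N → let m = suc m′ ; i = m +ℕ N in
                sum1 R i (λ j → Gq R q i j * Ginv j m) ≈ δ R i m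
  Ginv-column m′ N = begin
    sum1 R i (λ j → Gq R q i j * Ginv j m)
      ≈⟨ sum1≈Σ< i _ ⟩
    Σ< i f
      ≡⟨ ≡.cong (λ k → Σ< k f) (ℕ.+-suc m′ N) ⟨
    Σ< (m′ +ℕ suc N) f
      ≈⟨ Σ<-split m′ (suc N) f ⟩
    Σ< m′ f + Σ< (suc N) (λ s → f (m′ +ℕ s))
      ≈⟨ +-cong (Σ<-zero m′ (λ j j<m′ → trans (*-congˡ (reflexive (Ginv-above (s≤s j<m′)))) (zeroʳ _)))
                (Σ<-cong (suc N) diagonal-band) ⟩
    0# + alternatingSum N m m
      ≈⟨ +-identityˡ _ ⟩
    alternatingSum N m m
      ≈⟨ alternatingSum≈g N m m ℕ.≤-refl ⟩
    g ((m ∸ m) +ℕ N) N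
      ≡⟨ ≡.cong (λ k → g (k +ℕ N) N) (ℕ.n∸n≡0 m) ⟩
    g N N
      ≈⟨ g-diagonal m N ⟩
    δ R i m ∎
    where
    m = suc m′
    i = m +ℕ N
    f : ℕ → Carrier
    f j = Gq R q i (suc j) * Ginv (suc j) m
    diagonal-band : ∀ s → s < suc N → f (m′ +ℕ s) ≈ (g (m +ℕ N) (N ∸ s) * sgn R s) * D s m m
    diagonal-band s s≤N = begin
      Gq R q i (m +ℕ s) * Ginv (m +ℕ s) m
        ≡⟨ ≡.cong₂ _*_ (≡.trans (Gq≡g (ℕ.+-monoʳ-≤ m (ℕ.≤-pred s≤N))) (≡.cong (g i) (ℕ.[m+n]∸[m+o]≡n∸o m N s)))
                       (when-true _ (ℕ.≤⇒≤ᵇ (ℕ.m≤m+n m s))) ⟩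
      g i (N ∸ s) * (sgn R ((m +ℕ s) ∸ m) * D ((m +ℕ s) ∸ m) m m)
        ≡⟨ ≡.cong (λ k → g i (N ∸ s) * (sgn R k * D k m m)) (ℕ.m+n∸m≡n m s) ⟩
      g i (N ∸ s) * (sgn R s * D s m m)
        ≈⟨ *-assoc _ _ _ ⟨
      (g i (N ∸ s) * sgn R s) * D s m m ∎

  Ginv-isInverse : IsInverseOfG R q Ginv
  Ginv-isInverse i (suc m′) _ _ with suc m′ ℕ.≤? i
  ... | yes m≤i = ≡.subst (λ i → sum1 R i (λ j → Gq R q i j * Ginv j (suc m′)) ≈ δ R i (suc m′))
                          (ℕ.m+[n∸m]≡n m≤i) (Ginv-column m′ (i ∸ suc m′))
  ... | no m≰i = begin
    sum1 R i (λ j → Gq R q i j * Ginv j (suc m′))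
      ≈⟨ sum1≈Σ< i _ ⟩
    Σ< i (λ j → Gq R q i (suc j) * Ginv (suc j) (suc m′))
      ≈⟨ Σ<-zero i (λ j j<i → trans (*-congˡ (reflexive (Ginv-above (ℕ.<-≤-trans (s≤s j<i) i<m)))) (zeroʳ _)) ⟩
    0#
      ≡⟨ when-false 1# (λ t → ℕ.<⇒≢ i<m (ℕ.≡ᵇ⇒≡ i (suc m′) t)) ⟨
    δ R i (suc m′) ∎
    where
    i<m : i < suc m′
    i<m = ℕ.≰⇒> m≰i

  Gq-diagonal : ∀ j → 1 ≤ j → Gq R q j j ≈ 1#
  Gq-diagonal j _ = trans (reflexive (≡.trans (Gq≡g (ℕ.≤-refl {j})) (≡.cong (g j) (ℕ.n∸n≡0 j)))) (*-identityʳ 1#)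

  IsInverseOfG-unique : ∀ {H H′} → IsInverseOfG R q H → IsInverseOfG R q H′ →
                        ∀ j m → 1 ≤ j → 1 ≤ m → H j m ≈ H′ j m
  IsInverseOfG-unique {H} {H′} GH≈1 GH′≈1 j m 1≤j 1≤m =
    unitriangular-cancel (Gq R q) Gq-diagonal (λ j → H j m) (λ j → H′ j m)
      (λ i 1≤i → trans (GH≈1 i m 1≤i 1≤m) (sym (GH′≈1 i m 1≤i 1≤m))) j 1≤j

  -- Counting the fillings

  -- The local size function of `weight` takes the family itself as a module parameter; abstracting that
  -- parameter apart from the tail it is applied to lets Agda identify the function by unification.
  weight≡ : ∀ k l {n} (ts : Vec Row n) → weight R q k l ts ≡ q^ ((k *ℕ k ∸ l *ℕ l) ∸ ∣ ts ∣)
  weight≡ k l [] = ≡.refl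
  weight≡ k l {suc n} ((a , b) ∷ ts)
    with size-unique _ (λ _ → ≡.refl) (λ _ _ _ _ → ≡.refl) | suc n | (a , b) ∷ ts | n | ts
  ... | size≡ | _ | ts₀ | _ | ts′ = ≡.cong (λ s → q^ ((k *ℕ k ∸ l *ℕ l) ∸ (a +ℕ b +ℕ s))) (size≡ ts₀ ts′)

  weight-valid : ∀ {k l n} → k ≡ l +ℕ n → (ts : Vec Row n) → T (rows (suc l) ts) →
                 weight R q k l ts ≡ q^ (coSize (suc l) ts)
  weight-valid {l = l} {n} ≡.refl ts valid = ≡.trans (weight≡ (l +ℕ n) l ts) (≡.cong q^_ (weight-exponent l ts valid))

  Tsum-unfolded≈ : ∀ {k l n i} {fams : List (Vec Row n)} {ok : ∀ {m} → Vec Row m → Bool} (flt : Filter n) →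
               _≡_ {A = Filter n} filter flt →
               fams ≡ families k n → (∀ {m} (ts : Vec Row m) → ok ts ≡ rows (l +ℕ i) ts) → l +ℕ i ≡ suc l →
               sumL R (map (weight R q k l) (flt (λ ts → T? (ok ts)) fams))
               ≈ ΣL (λ ts → when (rows (suc l) ts) (weight R q k l ts)) (families k n)
  Tsum-unfolded≈ {k} {l} {fams = fams} {ok} _ ≡.refl ≡.refl ok≡rows l+i≡1+l =
    trans (ΣL-filter (weight R q k l) ok fams)
          (ΣL-cong fams (λ ts → reflexive (≡.cong (λ β → when β (weight R q k l ts))
                                                   (≡.trans (ok≡rows ts) (≡.cong (λ u → rows u ts) l+i≡1+l)))))

  -- Tsum is built from functions local to its definition, reachable only by unification: abstracting
  -- k ∸ l, the starting row index 1 and filter makes them solvable from the goal, and the uniqueness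
  -- lemmas identify them through their defining equations.
  Tsum≈ : ∀ k l → Tsum R q k l ≈ ΣL (λ ts → when (rows (suc l) ts) (weight R q k l ts)) (families k (k ∸ l))
  Tsum≈ k l
    with families-unique k _ ≡.refl (λ _ → ≡.refl)
       | rows-unique l _ (λ _ → ≡.refl) (λ _ _ _ _ → ≡.refl) _ (λ _ → ≡.refl) (λ _ _ _ _ → ≡.refl)
       | k ∸ l | 1 | ℕ.+-comm l 1
  ... | fams≡families | ok≡rows | n | i | l+i≡1+l with filter {A = Vec Row n} {p = 0ℓ} in filter≡flt
  ... | flt = Tsum-unfolded≈ flt filter≡flt (fams≡families n) (ok≡rows i) l+i≡1+l

  enumerate : ∀ {k} n m c → m +ℕ n ≤ k → c ≤ k →
              ΣL (λ ts → when (link c ts ∧ rows (suc m) ts) (q^ (coSize (suc m) ts))) (families k n) ≈ D n m c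
  enumerate zero m c _ _ = +-identityʳ 1#
  enumerate {k} (suc n) m c m+1+n≤k c≤k = begin
    ΣL F (families k (suc n))
      ≈⟨ ΣL-concatMap F _ (pairsUpTo k) ⟩
    ΣL (λ p → ΣL F (map (p ∷_) (families k n))) (pairsUpTo k)
      ≈⟨ ΣL-pairsUpTo k _ ⟩
    Σ< k (λ a → Σ< k λ b → ΣL F (map ((suc a , suc b) ∷_) (families k n)))
      ≈⟨ Σ<-cong k (λ a _ → Σ<-cong k (λ b _ → first-row a b)) ⟩
    Σ< k (λ a → Σ< k λ b → when (a <ᵇ suc m) (when (b <ᵇ c) (Inner a b)))
      ≈⟨ Σ<-cong k (λ a _ → Σ<-when k (a <ᵇ suc m) (λ b → when (b <ᵇ c) (Inner a b))) ⟩
    Σ< k (λ a → when (a <ᵇ suc m) (Σ< k λ b → when (b <ᵇ c) (Inner a b)))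
      ≈⟨ Σ<-restrict (_<ᵇ suc m) _ 1+m≤k (λ a → <ᵇ⇔< a (suc m)) ⟩
    Σ< (suc m) (λ a → Σ< k λ b → when (b <ᵇ c) (Inner a b))
      ≈⟨ Σ<-cong (suc m) (λ a _ → Σ<-restrict (_<ᵇ c) (Inner a) c≤k (λ b → <ᵇ⇔< b c)) ⟩
    D (suc n) m c ∎
    where
    F : Vec Row (suc n) → Carrier
    F ts = when (link c ts ∧ rows (suc m) ts) (q^ (coSize (suc m) ts))
    Inner : ℕ → ℕ → Carrier
    Inner a b = when (b <ᵇ a) (q^ ((m ∸ a) +ℕ (m ∸ suc b)) * D n (suc m) (suc a))
    1+m≤k : suc m ≤ k
    1+m≤k = ℕ.≤-trans (ℕ.≤-trans (ℕ.m≤m+n (suc m) n) (ℕ.≤-reflexive (≡.sym (ℕ.+-suc m n)))) m+1+n≤k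
    first-row : ∀ a b → ΣL F (map ((suc a , suc b) ∷_) (families k n)) ≈ when (a <ᵇ suc m) (when (b <ᵇ c) (Inner a b))
    first-row a b = begin
      ΣL F (map ((suc a , suc b) ∷_) (families k n))
        ≡⟨ ΣL-map F _ (families k n) ⟩
      ΣL (λ ts → when ((b <ᵇ c) ∧ (b <ᵇ a) ∧ (a <ᵇ suc m) ∧ rest ts) (q^ (e +ℕ co ts))) (families k n)
        ≈⟨ ΣL-when-∧ (b <ᵇ c) _ _ (families k n) ⟩
      when (b <ᵇ c) (ΣL (λ ts → when ((b <ᵇ a) ∧ (a <ᵇ suc m) ∧ rest ts) (q^ (e +ℕ co ts))) (families k n))
        ≈⟨ when-cong (b <ᵇ c) (λ _ → ΣL-when-∧ (b <ᵇ a) _ _ (families k n)) ⟩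
      when (b <ᵇ c) (when (b <ᵇ a) (ΣL (λ ts → when ((a <ᵇ suc m) ∧ rest ts) (q^ (e +ℕ co ts))) (families k n)))
        ≈⟨ when-cong (b <ᵇ c) (λ _ → when-cong (b <ᵇ a) (λ _ → ΣL-when-∧ (a <ᵇ suc m) _ _ (families k n))) ⟩
      when (b <ᵇ c) (when (b <ᵇ a) (when (a <ᵇ suc m) (ΣL (λ ts → when (rest ts) (q^ (e +ℕ co ts))) (families k n))))
        ≈⟨ when-cong (b <ᵇ c) (λ _ → when-cong (b <ᵇ a) (λ _ →
             when-cong (a <ᵇ suc m) (remaining-rows ∘ ℕ.<ᵇ⇒< a (suc m)))) ⟩
      when (b <ᵇ c) (when (b <ᵇ a) (when (a <ᵇ suc m) (q^ e * D n (suc m) (suc a))))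
        ≡⟨ ≡.trans (≡.cong (when (b <ᵇ c)) (when-comm (b <ᵇ a) (a <ᵇ suc m) _)) (when-comm (b <ᵇ c) (a <ᵇ suc m) _) ⟩
      when (a <ᵇ suc m) (when (b <ᵇ c) (Inner a b)) ∎
      where
      e = (m ∸ a) +ℕ (m ∸ suc b)
      rest : Vec Row n → Bool
      rest ts = link (suc a) ts ∧ rows (suc (suc m)) ts
      co : Vec Row n → ℕ
      co = coSize (suc (suc m))
      remaining-rows : a < suc m →
                       ΣL (λ ts → when (rest ts) (q^ (e +ℕ co ts))) (families k n) ≈ q^ e * D n (suc m) (suc a)
      remaining-rows a≤m = begin
        ΣL (λ ts → when (rest ts) (q^ (e +ℕ co ts))) (families k n)
          ≈⟨ ΣL-cong (families k n) (λ ts → trans (when-cong (rest ts) (λ _ → q^-+ e (co ts)))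
                                                  (sym (*-when (rest ts) _ _))) ⟩
        ΣL (λ ts → q^ e * when (rest ts) (q^ (co ts))) (families k n)
          ≈⟨ ΣL-*ˡ (q^ e) _ (families k n) ⟨
        q^ e * ΣL (λ ts → when (rest ts) (q^ (co ts))) (families k n)
          ≈⟨ *-congˡ (enumerate n (suc m) (suc a) (ℕ.≤-trans (ℕ.≤-reflexive (≡.sym (ℕ.+-suc m n))) m+1+n≤k)
                                                  (ℕ.≤-trans a≤m 1+m≤k)) ⟩
        q^ e * D n (suc m) (suc a) ∎

  Tsum≈D : ∀ {k l} → l ≤ k → Tsum R q k l ≈ D (k ∸ l) l l
  Tsum≈D {k} {l} l≤k = begin
    Tsum R q k l
      ≈⟨ Tsum≈ k l ⟩
    ΣL (λ ts → when (rows (suc l) ts) (weight R q k l ts)) (families k (k ∸ l))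
      ≈⟨ ΣL-cong (families k (k ∸ l)) (λ ts → when-∧-implied (rows⇒link ts)
                                                (reflexive ∘ weight-valid (≡.sym (ℕ.m+[n∸m]≡n l≤k)) ts)) ⟩
    ΣL (λ ts → when (link l ts ∧ rows (suc l) ts) (q^ (coSize (suc l) ts))) (families k (k ∸ l))
      ≈⟨ enumerate (k ∸ l) l l (ℕ.≤-reflexive (ℕ.m+[n∸m]≡n l≤k)) l≤k ⟩
    D (k ∸ l) l l ∎

theorem7 : {c ℓ : Level} (R : CommutativeRing c ℓ) (q : CommutativeRing.Carrier R)
           (H : ℕ → ℕ → CommutativeRing.Carrier R) → IsInverseOfG R q H →
           (k l : ℕ) → 1 ≤ l → l ≤ k →
           CommutativeRing._≈_ R (CommutativeRing._*_ R (sgn R (k ∸ l)) (H k l)) (Tsum R q k l)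
theorem7 R q H GH≈1 k l 1≤l l≤k = begin
  sgn R (k ∸ l) * H k l
    ≈⟨ *-congˡ (IsInverseOfG-unique R q GH≈1 (Ginv-isInverse R q) k l (ℕ.≤-trans 1≤l l≤k) 1≤l) ⟩
  sgn R (k ∸ l) * Ginv R q k l
    ≡⟨ ≡.cong (sgn R (k ∸ l) *_) (when-true _ (ℕ.≤⇒≤ᵇ l≤k)) ⟩
  sgn R (k ∸ l) * (sgn R (k ∸ l) * D R q (k ∸ l) l l)
    ≈⟨ *-assoc _ _ _ ⟨
  (sgn R (k ∸ l) * sgn R (k ∸ l)) * D R q (k ∸ l) l l
    ≈⟨ *-congʳ (sgn-square (k ∸ l)) ⟩
  1# * D R q (k ∸ l) l l
    ≈⟨ *-identityˡ _ ⟩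
  D R q (k ∸ l) l l
    ≈⟨ Tsum≈D R q l≤k ⟨
  Tsum R q k l ∎
  where
  open CommutativeRing R
  open Sums R using (when-true; sgn-square)
  open import Relation.Binary.Reasoning.Setoid setoid
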